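{- Every positive integer divides infinitely many sparsely totient numbers.
   Context: $\phi$ is Euler's totient function and $V$ its image. For $m\in V$, $N_1(m)=\max\{x\in\mathbb{N}:\phi(x)\le m\}$; the sparsely totient numbers are the elements of $N_1=\{N_1(m):m\in V\}$. -}

module Defs where

open import Data.Nat using (ℕ; zero; suc; _≤_; _<_; _≟_)
open import Data.Nat.GCD using (gcd)
open import Data.List using (List; length; filter; map; upTo)
open import Data.Product using (_×_; ∃-syntax)
open import Relation.Binary.PropositionalEquality using (_≡_)

φ : ℕ → ℕ
φ n = length (filter (λ k → gcd k n ≟ 1) (map suc (upTo n)))

InV : ℕ → Set
InV m = ∃[ y ] (1 ≤ y × φ y ≡ m)

IsN₁ : ℕ → ℕ → Set
IsN₁ m s = 1 ≤ s × φ s ≤ m × (∀ x → 1 ≤ x → φ x ≤ m → x ≤ s)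

SparselyTotient : ℕ → Set
SparselyTotient s = ∃[ m ] (InV m × IsN₁ m s)

module Submission where

-- Let Qⱼ = p₁ ⋯ pⱼ be the product of the first j primes and Rⱼ = φ(Qⱼ) = ∏ (pᵢ − 1).
-- Every x < Qⱼ₊₁ satisfies x / φ(x) ≤ Qⱼ / Rⱼ. This is proved for t-rough x against the
-- first primes ≥ t, by removing the least prime factor q of x, which leaves a (q + 1)-rough
-- cofactor; consequently φ(x) ≥ Rⱼ whenever x ≥ Qⱼ. Now take k = n + B and s = n Qₖ. As
-- every prime factor of n divides Qₖ, φ(s) = n Rₖ. If s < x < Qₖ₊₁ the ratio bound gives
-- φ(x) > n Rₖ, and if x ≥ Qₖ₊₁ then φ(x) ≥ Rₖ₊₁ = Rₖ (pₖ₊₁ − 1) > n Rₖ. So φ(x) > φ(s) for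
-- all x > s, i.e. s = N₁(φ(s)).

open import Data.List using ([]; _∷_; length; filter; map; applyUpTo)
open import Data.List.Membership.Propositional using (_∈_)
open import Data.List.Relation.Unary.All as All using (All; []; _∷_)
open import Data.Nat
open import Data.Nat.Coprimality as Coprimality
  using (Coprime; coprime?; coprime⇒gcd≡1; gcd≡1⇒coprime; coprime-divisor; coprime-+)
open import Data.Nat.Divisibility
open import Data.Nat.GCD using (gcd)
open import Data.Nat.Induction using (<-wellFounded)
open import Data.Nat.ListAction using (product)
open import Data.Nat.ListAction.Properties using (∈⇒∣product)
open import Data.Nat.Primality
open import Data.Nat.Primality.Factorisation using (module PrimeFactorisation; factorise)
open import Data.Nat.Properties
open import Algebra.Properties.CommutativeSemigroup +-commutativeSemigroup
  using () renaming (interchange to +-interchange)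
open import Algebra.Properties.CommutativeSemigroup *-commutativeSemigroup
  using (xy∙z≈xz∙y) renaming (interchange to *-interchange)
open import Data.Nat.Tactic.RingSolver using (solve-∀)
open import Data.Product using (∃-syntax; _×_; _,_; proj₁; proj₂)
open import Data.Sum using (inj₁; inj₂)
open import Function using (id; _∘_)
open import Induction.WellFounded using (Acc; acc)
open import Relation.Binary.PropositionalEquality
open import Relation.Nullary using (Dec; yes; no; ¬_; contradiction)
open import Relation.Unary using (Pred; Decidable)

open import Defs

private
  variable
    X Y : Set
    d j k m n p q t x : ℕ

𝟙 : Dec X → ℕ
𝟙 (yes _) = 1
𝟙 (no _)  = 0

𝟙-yes : X → (x? : Dec X) → 𝟙 x? ≡ 1
𝟙-yes _ (yes _)  = refl
𝟙-yes x (no ¬x) = contradiction x ¬x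

𝟙-no : ¬ X → (x? : Dec X) → 𝟙 x? ≡ 0
𝟙-no ¬x (yes x) = contradiction x ¬x
𝟙-no _  (no _)  = refl

𝟙-cong : (X → Y) → (Y → X) → (x? : Dec X) (y? : Dec Y) → 𝟙 x? ≡ 𝟙 y?
𝟙-cong f g (yes x) y? = sym (𝟙-yes (f x) y?)
𝟙-cong f g (no ¬x) y? = sym (𝟙-no (¬x ∘ g) y?)

∑ : ℕ → (ℕ → ℕ) → ℕ
∑ zero    f = 0
∑ (suc N) f = f 0 + ∑ N (f ∘ suc)

∑-cong : ∀ N {f g : ℕ → ℕ} → (∀ i → f i ≡ g i) → ∑ N f ≡ ∑ N g
∑-cong zero    f≗g = refl
∑-cong (suc N) f≗g = cong₂ _+_ (f≗g 0) (∑-cong N (f≗g ∘ suc))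

∑-≡0 : ∀ N {f : ℕ → ℕ} → (∀ {i} → i < N → f i ≡ 0) → ∑ N f ≡ 0
∑-≡0 zero    f≡0 = refl
∑-≡0 (suc N) f≡0 = cong₂ _+_ (f≡0 z<s) (∑-≡0 N (f≡0 ∘ s<s))

∑-+ : ∀ M N (f : ℕ → ℕ) → ∑ (M + N) f ≡ ∑ M f + ∑ N (f ∘ (M +_))
∑-+ zero    N f = refl
∑-+ (suc M) N f = trans (cong (f 0 +_) (∑-+ M N (f ∘ suc))) (sym (+-assoc (f 0) _ _))

∑-distrib : ∀ N (f g : ℕ → ℕ) → ∑ N (λ i → f i + g i) ≡ ∑ N f + ∑ N g
∑-distrib zero    f g = refl
∑-distrib (suc N) f g =
  trans (cong (f 0 + g 0 +_) (∑-distrib N (f ∘ suc) (g ∘ suc))) (+-interchange (f 0) (g 0) _ _)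

∑-snoc : ∀ N (f : ℕ → ℕ) → ∑ (suc N) f ≡ ∑ N f + f N
∑-snoc zero    f = +-comm (f 0) 0
∑-snoc (suc N) f = trans (cong (f 0 +_) (∑-snoc N (f ∘ suc))) (sym (+-assoc (f 0) _ _))

∑-rotate : ∀ N (f : ℕ → ℕ) → f N ≡ f 0 → ∑ N (f ∘ suc) ≡ ∑ N f
∑-rotate N f fN≡f0 = +-cancelˡ-≡ (f 0) _ _ (begin
  ∑ (suc N) f   ≡⟨ ∑-snoc N f ⟩
  ∑ N f + f N   ≡⟨ cong (∑ N f +_) fN≡f0 ⟩
  ∑ N f + f 0   ≡⟨ +-comm (∑ N f) (f 0) ⟩
  f 0 + ∑ N f   ∎)
  where open ≡-Reasoning

∑-periodic : ∀ b m (f : ℕ → ℕ) → (∀ i → f (m + i) ≡ f i) → ∑ (b * m) f ≡ b * ∑ m f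
∑-periodic zero    m f f-per = refl
∑-periodic (suc b) m f f-per = begin
  ∑ (m + b * m) f                 ≡⟨ ∑-+ m (b * m) f ⟩
  ∑ m f + ∑ (b * m) (f ∘ (m +_))  ≡⟨ cong (∑ m f +_) (∑-cong (b * m) f-per) ⟩
  ∑ m f + ∑ (b * m) f             ≡⟨ cong (∑ m f +_) (∑-periodic b m f f-per) ⟩
  ∑ m f + b * ∑ m f               ∎
  where open ≡-Reasoning

∑-multiples : ∀ N p .{{_ : NonZero p}} (f : ℕ → ℕ) →
              ∑ (N * p) (λ k → f k * 𝟙 (p ∣? k)) ≡ ∑ N (λ b → f (b * p))
∑-multiples zero    p f = refl
∑-multiples (suc N) p@(suc p′) f = begin
  ∑ (p + N * p) h                                  ≡⟨ ∑-+ p (N * p) h ⟩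
  ∑ p h + ∑ (N * p) (h ∘ (p +_))                   ≡⟨ cong₂ _+_ firstBlock (∑-cong (N * p) shift) ⟩
  f 0 + ∑ (N * p) (λ k → f (p + k) * 𝟙 (p ∣? k))  ≡⟨ cong (f 0 +_) (∑-multiples N p (f ∘ (p +_))) ⟩
  f 0 + ∑ N (λ b → f (p + b * p))                  ∎
  where
  open ≡-Reasoning
  h : ℕ → ℕ
  h k = f k * 𝟙 (p ∣? k)
  firstBlock : ∑ p h ≡ f 0
  firstBlock = begin
    h 0 + ∑ p′ (h ∘ suc)  ≡⟨ cong₂ _+_ (cong (f 0 *_) (𝟙-yes (p ∣0) (p ∣? 0))) (∑-≡0 p′ nonMultiple) ⟩
    f 0 * 1 + 0           ≡⟨ trans (+-identityʳ _) (*-identityʳ (f 0)) ⟩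
    f 0                   ∎
    where
    nonMultiple : ∀ {i} → i < p′ → h (suc i) ≡ 0
    nonMultiple {i} i<p′ =
      trans (cong (f (suc i) *_) (𝟙-no (<⇒≱ (s<s i<p′) ∘ ∣⇒≤) (p ∣? suc i))) (*-zeroʳ (f (suc i)))
  shift : ∀ k → h (p + k) ≡ f (p + k) * 𝟙 (p ∣? k)
  shift k = cong (f (p + k) *_)
    (𝟙-cong (λ p∣p+k → ∣m+n∣m⇒∣n p∣p+k ∣-refl) (∣m∣n⇒∣m+n ∣-refl) (p ∣? (p + k)) (p ∣? k))

length-filter-map-applyUpTo : ∀ {P : Pred ℕ _} (P? : Decidable P) (g f : ℕ → ℕ) N →
  length (filter P? (map g (applyUpTo f N))) ≡ ∑ N (λ i → 𝟙 (P? (g (f i))))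
length-filter-map-applyUpTo P? g f zero = refl
length-filter-map-applyUpTo P? g f (suc N) with P? (g (f 0))
... | yes _ = cong suc (length-filter-map-applyUpTo P? g (f ∘ suc) N)
... | no  _ = length-filter-map-applyUpTo P? g (f ∘ suc) N

[_⊥_] : ℕ → ℕ → ℕ
[ k ⊥ n ] = 𝟙 (coprime? k n)

[⊥]≡1 : Coprime k n → [ k ⊥ n ] ≡ 1
[⊥]≡1 {k} {n} k⊥n = 𝟙-yes (λ {i} → k⊥n {i}) (coprime? k n)

[⊥]≡0 : ¬ Coprime k n → [ k ⊥ n ] ≡ 0
[⊥]≡0 {k} {n} ¬k⊥n = 𝟙-no ¬k⊥n (coprime? k n)

coprime-∣ˡ : d ∣ k → Coprime k n → Coprime d n
coprime-∣ˡ d∣k k⊥n (i∣d , i∣n) = k⊥n (∣-trans i∣d d∣k , i∣n)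

coprime-∣ʳ : d ∣ n → Coprime k n → Coprime k d
coprime-∣ʳ d∣n k⊥n (i∣k , i∣d) = k⊥n (i∣k , ∣-trans i∣d d∣n)

coprime-* : Coprime k m → Coprime k n → Coprime k (m * n)
coprime-* k⊥m k⊥n (i∣k , i∣m*n) = k⊥n (i∣k , coprime-divisor (coprime-∣ˡ i∣k k⊥m) i∣m*n)

prime∤⇒coprime : Prime p → ¬ p ∣ k → Coprime k p
prime∤⇒coprime pp p∤k (i∣k , i∣p) with prime⇒irreducible pp i∣p
... | inj₁ i≡1 = i≡1
... | inj₂ refl = contradiction i∣k p∤k

[⊥]-periodic : ∀ m k → [ m + k ⊥ m ] ≡ [ k ⊥ m ]
[⊥]-periodic m k = 𝟙-cong shrink coprime-+ (coprime? (m + k) m) (coprime? k m)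
  where
  shrink : Coprime (m + k) m → Coprime k m
  shrink m+k⊥m (i∣k , i∣m) = m+k⊥m (∣m∣n⇒∣m+n i∣m i∣k , i∣m)

-- Summing over 0 ≤ k < n rather than 1 ≤ k ≤ n (the end terms agree) makes the summand n-periodic.
φ≡∑ : ∀ n → φ n ≡ ∑ n (λ k → [ k ⊥ n ])
φ≡∑ n = begin
  φ n                                    ≡⟨ length-filter-map-applyUpTo (λ k → gcd k n ≟ 1) suc id n ⟩
  ∑ n (λ i → 𝟙 (gcd (suc i) n ≟ 1))     ≡⟨ ∑-cong n (λ _ → 𝟙-cong gcd≡1⇒coprime coprime⇒gcd≡1 _ _) ⟩
  ∑ n (λ i → [ suc i ⊥ n ])              ≡⟨ ∑-rotate n (λ k → [ k ⊥ n ]) [n⊥n]≡[0⊥n] ⟩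
  ∑ n (λ k → [ k ⊥ n ])                  ∎
  where
  open ≡-Reasoning
  [n⊥n]≡[0⊥n] : [ n ⊥ n ] ≡ [ 0 ⊥ n ]
  [n⊥n]≡[0⊥n] = trans (cong [_⊥ n ] (sym (+-identityʳ n))) ([⊥]-periodic n 0)

∑[⊥]≡*φ : ∀ b m → ∑ (b * m) (λ k → [ k ⊥ m ]) ≡ b * φ m
∑[⊥]≡*φ b m = trans (∑-periodic b m _ ([⊥]-periodic m)) (cong (b *_) (sym (φ≡∑ m)))

d∣n⇒φ[d*n]≡d*φ[n] : d ∣ n → φ (d * n) ≡ d * φ n
d∣n⇒φ[d*n]≡d*φ[n] {d} {n} d∣n = begin
  φ (d * n)                        ≡⟨ φ≡∑ (d * n) ⟩
  ∑ (d * n) (λ k → [ k ⊥ d * n ])  ≡⟨ ∑-cong (d * n) (λ _ → 𝟙-cong forget remember _ _) ⟩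
  ∑ (d * n) (λ k → [ k ⊥ n ])      ≡⟨ ∑[⊥]≡*φ d n ⟩
  d * φ n                          ∎
  where
  open ≡-Reasoning
  forget : Coprime k (d * n) → Coprime k n
  forget = coprime-∣ʳ (n∣m*n d)
  remember : Coprime k n → Coprime k (d * n)
  remember k⊥n = coprime-∣ʳ (*-monoˡ-∣ n d∣n) (coprime-* k⊥n k⊥n)

p∤n⇒φ[p*n]≡[p∸1]*φ[n] : Prime p → ¬ p ∣ n → φ (p * n) ≡ (p ∸ 1) * φ n
p∤n⇒φ[p*n]≡[p∸1]*φ[n] {p} {n} pp p∤n = begin
  φ (p * n)                  ≡⟨ m+n∸n≡m (φ (p * n)) (φ n) ⟨
  φ (p * n) + φ n ∸ φ n      ≡⟨ cong (_∸ φ n) φ[p*n]+φ[n]≡p*φ[n] ⟩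
  p * φ n ∸ φ n              ≡⟨ cong (p * φ n ∸_) (*-identityˡ (φ n)) ⟨
  p * φ n ∸ 1 * φ n          ≡⟨ *-distribʳ-∸ (φ n) p 1 ⟨
  (p ∸ 1) * φ n              ∎
  where
  open ≡-Reasoning
  instance _ = prime⇒nonZero pp

  coprimeMultiple : ℕ → ℕ
  coprimeMultiple k = [ k ⊥ n ] * 𝟙 (p ∣? k)

  multiples : ∑ (p * n) coprimeMultiple ≡ φ n
  multiples = begin
    ∑ (p * n) coprimeMultiple                 ≡⟨ cong (λ N → ∑ N coprimeMultiple) (*-comm p n) ⟩
    ∑ (n * p) coprimeMultiple                 ≡⟨ ∑-multiples n p (λ k → [ k ⊥ n ]) ⟩
    ∑ n (λ b → [ b * p ⊥ n ])                  ≡⟨ ∑-cong n (λ _ → 𝟙-cong detach attach _ _) ⟩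
    ∑ n (λ b → [ b ⊥ n ])                      ≡⟨ φ≡∑ n ⟨
    φ n                                        ∎
    where
    detach : ∀ {b} → Coprime (b * p) n → Coprime b n
    detach = coprime-∣ˡ (m∣m*n p)
    attach : ∀ {b} → Coprime b n → Coprime (b * p) n
    attach b⊥n = Coprimality.sym (coprime-* (Coprimality.sym b⊥n) (prime∤⇒coprime pp p∤n))

  sieve : ∀ k → [ k ⊥ p * n ] + coprimeMultiple k ≡ [ k ⊥ n ]
  sieve k with coprime? k n | p ∣? k
  ... | yes k⊥n | yes p∣k =
    cong (_+ 1) ([⊥]≡0 (λ k⊥pn → nonTrivial⇒≢1 {{prime⇒nonTrivial pp}} (k⊥pn (p∣k , m∣m*n n))))
  ... | yes k⊥n | no  p∤k = trans (+-identityʳ _) ([⊥]≡1 (coprime-* (prime∤⇒coprime pp p∤k) k⊥n))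
  ... | no ¬k⊥n | _       = trans (+-identityʳ _) ([⊥]≡0 (¬k⊥n ∘ coprime-∣ʳ (n∣m*n p)))

  φ[p*n]+φ[n]≡p*φ[n] : φ (p * n) + φ n ≡ p * φ n
  φ[p*n]+φ[n]≡p*φ[n] = begin
    φ (p * n) + φ n                                                ≡⟨ cong₂ _+_ (φ≡∑ (p * n)) (sym multiples) ⟩
    ∑ (p * n) (λ k → [ k ⊥ p * n ]) + ∑ (p * n) coprimeMultiple     ≡⟨ ∑-distrib (p * n) _ _ ⟨
    ∑ (p * n) (λ k → [ k ⊥ p * n ] + coprimeMultiple k)            ≡⟨ ∑-cong (p * n) sieve ⟩
    ∑ (p * n) (λ k → [ k ⊥ n ])                                    ≡⟨ ∑[⊥]≡*φ p n ⟩
    p * φ n                                                        ∎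

φ-*-product : ∀ ps → All (_∣ m) ps → φ (product ps * m) ≡ product ps * φ m
φ-*-product {m} []       []               = trans (cong φ (+-identityʳ m)) (sym (+-identityʳ (φ m)))
φ-*-product {m} (p ∷ ps) (p∣m ∷ ps∣m) = begin
  φ (p * product ps * m)      ≡⟨ cong φ (*-assoc p (product ps) m) ⟩
  φ (p * (product ps * m))    ≡⟨ d∣n⇒φ[d*n]≡d*φ[n] (∣n⇒∣m*n (product ps) p∣m) ⟩
  p * φ (product ps * m)      ≡⟨ cong (p *_) (φ-*-product ps ps∣m) ⟩
  p * (product ps * φ m)      ≡⟨ *-assoc p (product ps) (φ m) ⟨
  p * product ps * φ m        ∎
  where open ≡-Reasoning

primes∣m⇒φ[n*m]≡n*φ[m] : .{{_ : NonZero n}} → (∀ {p} → Prime p → p ∣ n → p ∣ m) →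
                          φ (n * m) ≡ n * φ m
primes∣m⇒φ[n*m]≡n*φ[m] {n} {m} primes∣m = begin
  φ (n * m)            ≡⟨ cong (λ n → φ (n * m)) n≡Πps ⟩
  φ (product ps * m)   ≡⟨ φ-*-product ps (All.tabulate ps∣m) ⟩
  product ps * φ m     ≡⟨ cong (_* φ m) n≡Πps ⟨
  n * φ m              ∎
  where
  open ≡-Reasoning
  open PrimeFactorisation (factorise n)
    renaming (factors to ps; isFactorisation to n≡Πps; factorsPrime to ps-prime)
  ps∣m : p ∈ ps → p ∣ m
  ps∣m p∈ps = primes∣m (All.lookup ps-prime p∈ps) (subst (_ ∣_) (sym n≡Πps) (∈⇒∣product p∈ps))

leastPrimeFactor≥ : 2 ≤ t → 2 ≤ x → t Rough x → ∃[ q ] (t ≤ q × Prime q × q ∣ x × q Rough x)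
leastPrimeFactor≥ {t} {x} 2≤t 2≤x t-rough =
  search t (x ∸ t) 2≤t (m+[n∸m]≡n (rough⇒≤ {{n>1⇒nonTrivial 2≤x}} t-rough)) t-rough
  where
  search : ∀ u d → 2 ≤ u → u + d ≡ x → u Rough x → ∃[ q ] (u ≤ q × Prime q × q ∣ x × q Rough x)
  search u d 2≤u u+d≡x u-rough with u ∣? x
  ... | yes u∣x = u , ≤-refl , rough∧∣⇒prime {{n>1⇒nonTrivial 2≤u}} u-rough u∣x , u∣x , u-rough
  search u zero    2≤u u+0≡x u-rough | no u∤x =
    contradiction (subst (u ∣_) (trans (sym (+-identityʳ u)) u+0≡x) ∣-refl) u∤x
  search u (suc d) 2≤u u+d≡x u-rough | no u∤x
    with search (suc u) d (m≤n⇒m≤1+n 2≤u) (trans (sym (+-suc u d)) u+d≡x) (∤⇒rough-suc u∤x u-rough)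
  ... | q , u<q , q-factor = q , <⇒≤ u<q , q-factor

n∣n! : ∀ n → .{{_ : NonZero n}} → n ∣ n !
n∣n! (suc n) = m∣m*n (n !)

prime≥ : ∀ t → ∃[ p ] (t ≤ p × Prime p)
prime≥ t with leastPrimeFactor≥ ≤-refl (+-monoˡ-≤ 1 (1≤n! t)) 2-rough
... | q , _ , q-prime , q∣t!+1 , _ with t <? q
...   | yes t<q = q , <⇒≤ t<q , q-prime
...   | no  t≮q =
  contradiction (∣1⇒≡1 (∣m+n∣m⇒∣n q∣t!+1 q∣t!)) (nonTrivial⇒≢1 {{prime⇒nonTrivial q-prime}})
  where
  instance _ = prime⇒nonZero q-prime
  q∣t! : q ∣ t !
  q∣t! = ∣-trans (n∣n! q) (m≤n⇒m!∣n! (≮⇒≥ t≮q))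

leastPrime≥ : ∀ t → ∃[ q ] (t ≤ q × Prime q × (∀ {p} → Prime p → t ≤ p → q ≤ p))
leastPrime≥ t with prime≥ t
... | p , t≤p , p-prime = search t (p ∸ t) (m+[n∸m]≡n t≤p)
  where
  search : ∀ u d → u + d ≡ p → ∃[ q ] (u ≤ q × Prime q × (∀ {r} → Prime r → u ≤ r → q ≤ r))
  search u d u+d≡p with prime? u
  ... | yes u-prime = u , ≤-refl , u-prime , λ _ u≤r → u≤r
  search u zero    u+0≡p | no ¬u-prime =
    contradiction (subst Prime (sym (trans (sym (+-identityʳ u)) u+0≡p)) p-prime) ¬u-prime
  search u (suc d) u+d≡p | no ¬u-prime with search (suc u) d (trans (sym (+-suc u d)) u+d≡p)
  ... | q , u<q , q-prime , q-least = q , <⇒≤ u<q , q-prime , λ r-prime u≤r →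
        q-least r-prime (≤∧≢⇒< u≤r (λ u≡r → ¬u-prime (subst Prime (sym u≡r) r-prime)))

abstract
  nextPrime : ℕ → ℕ
  nextPrime t = proj₁ (leastPrime≥ t)

  t≤nextPrime : ∀ t → t ≤ nextPrime t
  t≤nextPrime t = proj₁ (proj₂ (leastPrime≥ t))

  nextPrime-prime : ∀ t → Prime (nextPrime t)
  nextPrime-prime t = proj₁ (proj₂ (proj₂ (leastPrime≥ t)))

  nextPrime-least : ∀ t → Prime p → t ≤ p → nextPrime t ≤ p
  nextPrime-least t = proj₂ (proj₂ (proj₂ (leastPrime≥ t)))

nextPrime-mono-≤ : t ≤ q → nextPrime t ≤ nextPrime q
nextPrime-mono-≤ {t} {q} t≤q = nextPrime-least t (nextPrime-prime q) (≤-trans t≤q (t≤nextPrime q))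

2≤nextPrime : ∀ t → 2 ≤ nextPrime t
2≤nextPrime t = nonTrivial⇒n>1 (nextPrime t) {{prime⇒nonTrivial (nextPrime-prime t)}}

-- primorial t j is the product of the j least primes ≥ t, totientPrimorial t j its totient,
-- and nthPrime t j the (j + 1)-st least prime ≥ t.
primorial : ℕ → ℕ → ℕ
primorial t zero    = 1
primorial t (suc j) = nextPrime t * primorial (suc (nextPrime t)) j

totientPrimorial : ℕ → ℕ → ℕ
totientPrimorial t zero    = 1
totientPrimorial t (suc j) = (nextPrime t ∸ 1) * totientPrimorial (suc (nextPrime t)) j

nthPrime : ℕ → ℕ → ℕ
nthPrime t zero    = nextPrime t
nthPrime t (suc j) = nthPrime (suc (nextPrime t)) j

1≤primorial : ∀ t j → 1 ≤ primorial t j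
1≤primorial t zero    = ≤-refl
1≤primorial t (suc j) =
  *-mono-≤ (≤-trans (s≤s z≤n) (2≤nextPrime t)) (1≤primorial (suc (nextPrime t)) j)

1≤totientPrimorial : ∀ t j → 1 ≤ totientPrimorial t j
1≤totientPrimorial t zero    = ≤-refl
1≤totientPrimorial t (suc j) =
  *-mono-≤ (∸-monoˡ-≤ 1 (2≤nextPrime t)) (1≤totientPrimorial (suc (nextPrime t)) j)

totientPrimorial≤primorial : ∀ t j → totientPrimorial t j ≤ primorial t j
totientPrimorial≤primorial t zero    = ≤-refl
totientPrimorial≤primorial t (suc j) =
  *-mono-≤ (m∸n≤m (nextPrime t) 1) (totientPrimorial≤primorial (suc (nextPrime t)) j)

primorial-mono-≤ : ∀ j → t ≤ q → primorial t j ≤ primorial q j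
primorial-mono-≤ zero    t≤q = ≤-refl
primorial-mono-≤ (suc j) t≤q =
  *-mono-≤ (nextPrime-mono-≤ t≤q) (primorial-mono-≤ j (s≤s (nextPrime-mono-≤ t≤q)))

primorial-suc-≤ : ∀ j → nextPrime t ≤ q → primorial t (suc j) ≤ q * primorial (suc q) j
primorial-suc-≤ j a≤q = *-mono-≤ a≤q (primorial-mono-≤ j (s≤s a≤q))

j<primorial : ∀ t j → j < primorial t j
j<primorial t zero    = ≤-refl
j<primorial t (suc j) = begin
  2 + j                                        ≤⟨ s≤s (m≤n+m (suc j) j) ⟩
  suc j + suc j                                ≡⟨ cong (suc j +_) (+-identityʳ (suc j)) ⟨
  2 * suc j                                    ≤⟨ *-mono-≤ (2≤nextPrime t) (j<primorial (suc (nextPrime t)) j) ⟩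
  nextPrime t * primorial (suc (nextPrime t)) j ∎
  where open ≤-Reasoning

t+j≤nthPrime : ∀ t j → t + j ≤ nthPrime t j
t+j≤nthPrime t zero    = subst (_≤ nextPrime t) (sym (+-identityʳ t)) (t≤nextPrime t)
t+j≤nthPrime t (suc j) = begin
  t + suc j                 ≡⟨ +-suc t j ⟩
  suc t + j                 ≤⟨ +-monoˡ-≤ j (s≤s (t≤nextPrime t)) ⟩
  suc (nextPrime t) + j     ≤⟨ t+j≤nthPrime (suc (nextPrime t)) j ⟩
  nthPrime t (suc j)        ∎
  where open ≤-Reasoning

j<nthPrime∸1 : ∀ j → j < nthPrime 2 j ∸ 1
j<nthPrime∸1 j = ∸-monoˡ-≤ 1 (t+j≤nthPrime 2 j)

totientPrimorial-suc : ∀ t j → totientPrimorial t (suc j) ≡ totientPrimorial t j * (nthPrime t j ∸ 1)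
totientPrimorial-suc t zero    = *-comm (nextPrime t ∸ 1) 1
totientPrimorial-suc t (suc j) = begin
  a-1 * totientPrimorial (suc a) (suc j)                     ≡⟨ cong (a-1 *_) (totientPrimorial-suc (suc a) j) ⟩
  a-1 * (totientPrimorial (suc a) j * (nthPrime (suc a) j ∸ 1)) ≡⟨ *-assoc a-1 _ _ ⟨
  a-1 * totientPrimorial (suc a) j * (nthPrime (suc a) j ∸ 1)   ∎
  where
  open ≡-Reasoning
  a = nextPrime t
  a-1 = a ∸ 1

prime∣primorial : Prime q → t ≤ q → q < t + j → q ∣ primorial t j
prime∣primorial {q} {t} {zero}  _ t≤q q<t+0 = contradiction (subst (q <_) (+-identityʳ t) q<t+0) (≤⇒≯ t≤q)
prime∣primorial {q} {t} {suc j} q-prime t≤q q<t+j with nextPrime t ≟ q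
... | yes refl = m∣m*n (primorial (suc q) j)
... | no  a≢q  = ∣n⇒∣m*n (nextPrime t) (prime∣primorial q-prime a<q (begin-strict
  q                      <⟨ q<t+j ⟩
  t + suc j              ≡⟨ +-suc t j ⟩
  suc t + j              ≤⟨ +-monoˡ-≤ j (s≤s (t≤nextPrime t)) ⟩
  suc (nextPrime t) + j  ∎))
  where
  open ≤-Reasoning
  a<q : nextPrime t < q
  a<q = ≤∧≢⇒< (nextPrime-least t q-prime t≤q) a≢q

prime∤primorial : Prime q → q < t → ¬ q ∣ primorial t j
prime∤primorial {j = zero}  q-prime q<t q∣1 = nonTrivial⇒≢1 {{prime⇒nonTrivial q-prime}} (∣1⇒≡1 q∣1)
prime∤primorial {q} {t} {suc j} q-prime q<t q∣a*Q with euclidsLemma (nextPrime t) _ q-prime q∣a*Q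
... | inj₂ q∣Q = prime∤primorial {j = j} q-prime (<-≤-trans q<t (m≤n⇒m≤1+n (t≤nextPrime t))) q∣Q
... | inj₁ q∣a with prime⇒irreducible (nextPrime-prime t) q∣a
...   | inj₁ q≡1 = nonTrivial⇒≢1 {{prime⇒nonTrivial q-prime}} q≡1
...   | inj₂ q≡a = <⇒≱ q<t (subst (t ≤_) (sym q≡a) (t≤nextPrime t))

φ-primorial : ∀ t j → φ (primorial t j) ≡ totientPrimorial t j
φ-primorial t zero    = refl
φ-primorial t (suc j) = begin
  φ (a * primorial (suc a) j)           ≡⟨ p∤n⇒φ[p*n]≡[p∸1]*φ[n] a-prime (prime∤primorial {j = j} a-prime ≤-refl) ⟩
  (a ∸ 1) * φ (primorial (suc a) j)     ≡⟨ cong ((a ∸ 1) *_) (φ-primorial (suc a) j) ⟩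
  (a ∸ 1) * totientPrimorial (suc a) j  ∎
  where
  open ≡-Reasoning
  a = nextPrime t
  a-prime = nextPrime-prime t

m≤n⇒[m∸1]*n≤[n∸1]*m : m ≤ n → (m ∸ 1) * n ≤ (n ∸ 1) * m
m≤n⇒[m∸1]*n≤[n∸1]*m {m} {n} m≤n = begin
  (m ∸ 1) * n      ≡⟨ *-distribʳ-∸ n m 1 ⟩
  m * n ∸ 1 * n    ≤⟨ ∸-monoʳ-≤ (m * n) (*-monoʳ-≤ 1 m≤n) ⟩
  m * n ∸ 1 * m    ≡⟨ cong (_∸ 1 * m) (*-comm m n) ⟩
  n * m ∸ 1 * m    ≡⟨ *-distribʳ-∸ m n 1 ⟨
  (n ∸ 1) * m      ∎
  where open ≤-Reasoning

primorial-ratio-antitone : ∀ j → t ≤ q →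
  totientPrimorial t j * primorial q j ≤ totientPrimorial q j * primorial t j
primorial-ratio-antitone zero    t≤q = ≤-refl
primorial-ratio-antitone {t} {q} (suc j) t≤q = begin
  ((a ∸ 1) * R a) * (b * Q b)    ≡⟨ *-interchange (a ∸ 1) (R a) b (Q b) ⟩
  ((a ∸ 1) * b) * (R a * Q b)    ≤⟨ *-mono-≤ (m≤n⇒[m∸1]*n≤[n∸1]*m a≤b) (primorial-ratio-antitone j 1+a≤1+b) ⟩
  ((b ∸ 1) * a) * (R b * Q a)    ≡⟨ *-interchange (b ∸ 1) a (R b) (Q a) ⟩
  ((b ∸ 1) * R b) * (a * Q a)    ∎
  where
  open ≤-Reasoning
  a = nextPrime t
  b = nextPrime q
  a≤b = nextPrime-mono-≤ t≤q
  1+a≤1+b = s≤s a≤b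
  R = λ p → totientPrimorial (suc p) j
  Q = λ p → primorial (suc p) j

φ-ratio-bound-∣ : ∀ {q y r s} → q ∣ y → y * r ≤ φ y * s → q * y * r ≤ φ (q * y) * s
φ-ratio-bound-∣ {q} {y} {r} {s} q∣y y-bound = begin
  q * y * r      ≡⟨ *-assoc q y r ⟩
  q * (y * r)    ≤⟨ *-monoʳ-≤ q y-bound ⟩
  q * (φ y * s)  ≡⟨ *-assoc q (φ y) s ⟨
  q * φ y * s    ≡⟨ cong (_* s) (d∣n⇒φ[d*n]≡d*φ[n] q∣y) ⟨
  φ (q * y) * s  ∎
  where open ≤-Reasoning

φ-ratio-bound-step : ∀ {q y t} j → Prime q → ¬ q ∣ y → nextPrime t ≤ q →
                     y * totientPrimorial (suc q) j ≤ φ y * primorial (suc q) j →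
                     q * y * totientPrimorial t (suc j) ≤ φ (q * y) * primorial t (suc j)
φ-ratio-bound-step {q} {y} {t} j q-prime q∤y a≤q y-bound = *-cancelʳ-≤ _ _ D (begin
  q * y * ((a ∸ 1) * A) * D      ≡⟨ regroup₁ q y (a ∸ 1) A D ⟩
  (a ∸ 1) * q * y * (A * D)      ≤⟨ *-monoʳ-≤ ((a ∸ 1) * q * y) (primorial-ratio-antitone j (s≤s a≤q)) ⟩
  (a ∸ 1) * q * y * (C * B)      ≡⟨ regroup₂ ((a ∸ 1) * q) y C B ⟩
  (a ∸ 1) * q * (y * C) * B      ≤⟨ *-monoˡ-≤ B (*-monoʳ-≤ ((a ∸ 1) * q) y-bound) ⟩
  (a ∸ 1) * q * (φ y * D) * B    ≤⟨ *-monoˡ-≤ B (*-monoˡ-≤ (φ y * D) (m≤n⇒[m∸1]*n≤[n∸1]*m a≤q)) ⟩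
  (q ∸ 1) * a * (φ y * D) * B    ≡⟨ regroup₃ (q ∸ 1) a (φ y) D B ⟩
  (q ∸ 1) * φ y * (a * B) * D    ≡⟨ cong (λ z → z * (a * B) * D) (p∤n⇒φ[p*n]≡[p∸1]*φ[n] q-prime q∤y) ⟨
  φ (q * y) * (a * B) * D        ∎)
  where
  open ≤-Reasoning
  a = nextPrime t
  A = totientPrimorial (suc a) j
  B = primorial (suc a) j
  C = totientPrimorial (suc q) j
  D = primorial (suc q) j
  instance _ = >-nonZero (1≤primorial (suc q) j)
  regroup₁ : ∀ q y c A D → q * y * (c * A) * D ≡ c * q * y * (A * D)
  regroup₁ = solve-∀
  regroup₂ : ∀ c y C B → c * y * (C * B) ≡ c * (y * C) * B
  regroup₂ = solve-∀
  regroup₃ : ∀ c a f D B → c * a * (f * D) * B ≡ c * f * (a * B) * D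
  regroup₃ = solve-∀

φ-ratio-bound : ∀ j → 2 ≤ t → 1 ≤ x → t Rough x → x < primorial t (suc j) →
                x * totientPrimorial t j ≤ φ x * primorial t j
φ-ratio-bound {x = x} = go (<-wellFounded x)
  where
  go : ∀ {t x} → Acc _<_ x → ∀ j → 2 ≤ t → 1 ≤ x → t Rough x → x < primorial t (suc j) →
       x * totientPrimorial t j ≤ φ x * primorial t j
  go {t} {x = 1} _ j _ _ _ _ = *-monoʳ-≤ 1 (totientPrimorial≤primorial t j)
  go {t} {x@(2+ _)} (acc smaller) j 2≤t _ t-rough x<Q with leastPrimeFactor≥ 2≤t (s≤s (s≤s z≤n)) t-rough
  ... | q , t≤q , q-prime , q∣x , q-rough =
    subst (λ z → z * totientPrimorial t j ≤ φ z * primorial t j) (sym x≡q*y) (bound j x<Q)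
    where
    instance
      _ = prime⇒nonTrivial q-prime
      _ = quotient≢0 q∣x
    y = quotient q∣x
    x≡q*y = m∣n⇒n≡m*quotient q∣x
    y<x : y < x
    y<x = quotient-< q∣x
    a≤q : nextPrime t ≤ q
    a≤q = nextPrime-least t q-prime t≤q
    bound : ∀ j → x < primorial t (suc j) → q * y * totientPrimorial t j ≤ φ (q * y) * primorial t j
    bound zero    x<a = contradiction (subst (x <_) (*-identityʳ _) x<a) (≤⇒≯ (≤-trans a≤q (∣⇒≤ q∣x)))
    bound (suc j) x<Q with q ∣? y
    ... | yes q∣y = φ-ratio-bound-∣ q∣y (go (smaller y<x) (suc j) 2≤t (>-nonZero⁻¹ y) y-rough (<-trans y<x x<Q))
      where
      y-rough : t Rough y
      y-rough = rough∧∣⇒rough t-rough (quotient-∣ q∣x)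
    ... | no q∤y = φ-ratio-bound-step j q-prime q∤y a≤q
                     (go (smaller y<x) j (m≤n⇒m≤1+n (≤-trans 2≤t t≤q)) (>-nonZero⁻¹ y) y-rough y<Q)
      where
      y-rough : suc q Rough y
      y-rough = ∤⇒rough-suc q∤y (rough∧∣⇒rough q-rough (quotient-∣ q∣x))
      y<Q : y < primorial (suc q) (suc j)
      y<Q = *-cancelˡ-< q y _
        (subst (_< q * primorial (suc q) (suc j)) x≡q*y (<-≤-trans x<Q (primorial-suc-≤ (suc j) a≤q)))

primorial≤⇒totientPrimorial≤φ : ∀ j → 1 ≤ x → primorial 2 j ≤ x → totientPrimorial 2 j ≤ φ x
primorial≤⇒totientPrimorial≤φ {x} j 1≤x = search j x (m≤n+m x j)
  where
  search : ∀ j d → x ≤ j + d → primorial 2 j ≤ x → totientPrimorial 2 j ≤ φ x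
  search j d x≤j+d Q≤x with x <? primorial 2 (suc j)
  ... | yes x<Q′ = *-cancelʳ-≤ _ _ (primorial 2 j) {{>-nonZero (1≤primorial 2 j)}} (begin
    totientPrimorial 2 j * primorial 2 j  ≤⟨ *-monoʳ-≤ (totientPrimorial 2 j) Q≤x ⟩
    totientPrimorial 2 j * x              ≡⟨ *-comm (totientPrimorial 2 j) x ⟩
    x * totientPrimorial 2 j              ≤⟨ φ-ratio-bound j ≤-refl 1≤x 2-rough x<Q′ ⟩
    φ x * primorial 2 j                   ∎)
    where open ≤-Reasoning
  search j zero x≤j+0 Q≤x | no _ =
    contradiction (≤-<-trans (subst (x ≤_) (+-identityʳ j) x≤j+0) (j<primorial 2 j)) (≤⇒≯ Q≤x)
  search j (suc d) x≤j+d Q≤x | no x≮Q′ = begin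
    totientPrimorial 2 j                       ≤⟨ m≤m*n _ _ {{>-nonZero (≤-<-trans z≤n (j<nthPrime∸1 j))}} ⟩
    totientPrimorial 2 j * (nthPrime 2 j ∸ 1)  ≡⟨ totientPrimorial-suc 2 j ⟨
    totientPrimorial 2 (suc j)                 ≤⟨ search (suc j) d x≤1+j+d (≮⇒≥ x≮Q′) ⟩
    φ x                                        ∎
    where
    open ≤-Reasoning
    x≤1+j+d = subst (x ≤_) (+-suc j d) x≤j+d

n*totientPrimorial<φ : n ≤ j → n * primorial 2 j < x → n * totientPrimorial 2 j < φ x
n*totientPrimorial<φ {n} {j} {x} n≤j s<x with x <? primorial 2 (suc j)
... | yes x<Q′ = *-cancelʳ-< Q _ _ (begin-strict
  n * R * Q    ≡⟨ xy∙z≈xz∙y n R Q ⟩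
  n * Q * R    <⟨ *-monoˡ-< R s<x ⟩
  x * R        ≤⟨ φ-ratio-bound j ≤-refl (≤-<-trans z≤n s<x) 2-rough x<Q′ ⟩
  φ x * Q      ∎)
  where
  open ≤-Reasoning
  R = totientPrimorial 2 j
  Q = primorial 2 j
  instance _ = >-nonZero (1≤totientPrimorial 2 j)
... | no x≮Q′ = begin-strict
  n * R                       <⟨ *-monoˡ-< R (≤-<-trans n≤j (j<nthPrime∸1 j)) ⟩
  (nthPrime 2 j ∸ 1) * R      ≡⟨ *-comm _ R ⟩
  R * (nthPrime 2 j ∸ 1)      ≡⟨ totientPrimorial-suc 2 j ⟨
  totientPrimorial 2 (suc j)  ≤⟨ primorial≤⇒totientPrimorial≤φ (suc j) (≤-<-trans z≤n s<x) (≮⇒≥ x≮Q′) ⟩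
  φ x                         ∎
  where
  open ≤-Reasoning
  R = totientPrimorial 2 j
  instance _ = >-nonZero (1≤totientPrimorial 2 j)

φ-grows-above⇒sparselyTotient : ∀ {s} → 1 ≤ s → (∀ {x} → s < x → φ s < φ x) → SparselyTotient s
φ-grows-above⇒sparselyTotient {s} 1≤s φ-grows = φ s , (s , 1≤s , refl) , 1≤s , ≤-refl , maximal
  where
  maximal : ∀ x → 1 ≤ x → φ x ≤ φ s → x ≤ s
  maximal x _ φx≤φs = ≮⇒≥ (λ s<x → ≤⇒≯ φx≤φs (φ-grows s<x))

corollary3 : ∀ (n : ℕ) → 1 ≤ n → ∀ (B : ℕ) →
    ∃[ s ] (B < s × n ∣ s × SparselyTotient s)
corollary3 n 1≤n B = n * Q , B<n*Q , m∣m*n Q , φ-grows-above⇒sparselyTotient (≤-<-trans z≤n B<n*Q) φ-grows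
  where
  instance _ = >-nonZero 1≤n
  Q = primorial 2 (n + B)
  B<n*Q : B < n * Q
  B<n*Q = <-≤-trans (<-≤-trans (s≤s (m≤n+m B n)) (j<primorial 2 (n + B))) (m≤n*m Q n)
  primes∣Q : ∀ {p} → Prime p → p ∣ n → p ∣ Q
  primes∣Q p-prime p∣n = prime∣primorial p-prime (nonTrivial⇒n>1 _ {{prime⇒nonTrivial p-prime}})
    (s≤s (m≤n⇒m≤1+n (≤-trans (∣⇒≤ p∣n) (m≤m+n n B))))
  φ[n*Q] : φ (n * Q) ≡ n * totientPrimorial 2 (n + B)
  φ[n*Q] = trans (primes∣m⇒φ[n*m]≡n*φ[m] primes∣Q) (cong (n *_) (φ-primorial 2 (n + B)))
  φ-grows : ∀ {x} → n * Q < x → φ (n * Q) < φ x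
  φ-grows {x} n*Q<x = subst (_< φ x) (sym φ[n*Q]) (n*totientPrimorial<φ (m≤m+n n B) n*Q<x)
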